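{- Let $n\geq 2$ and let $a=(0,a_2,\ldots,a_k)$ (with $k\geq 2$) be a strong $(n-1)$-admissible $k$-tuple with $gap(a)<p_n-1$. Let $t'$ be an $(n-1)$-totative number satisfying $a$ at level $n-1$ such that $a[t']$ is isolated at level $n-1$. Then among the $p_n$ tuples $a[t'+j\,\#(n-1)]$, $j=0,1,\ldots,p_n-1$, exactly $p_n-k$ are $n$-totative $k$-tuples, i.e. have all entries $n$-totative, that are isolated at level $n$.
   Context: $p_i$ denotes the $i$th prime. The primorial is $\#(m)=\prod_{i=1}^{m}p_i$ for $m\geq 1$. The $m$-primorial set is $\{2,\ldots,\#(m)+1\}$; an $m$-totative number is an element of it coprime to $\#(m)$. For a $k$-tuple $a=(a_1,\ldots,a_k)$ and an integer $t$, write $a[t]=(t+a_1,\ldots,t+a_k)$; $a[t]$ is an $m$-totative $k$-tuple if all its entries are $m$-totative, in which case $t$ satisfies $a$ at level $m$. The tuple $a$ is $m$-admissible if $a_1=0$, $a_{i-1}<a_i$ for all $i\geq 2$, and for every $m'\geq m$ some $m'$-totative number satisfies $a$ at level $m'$. An $m$-admissible tuple is strong if for every $m'\geq m$ the residues $a_1,\ldots,a_k$ modulo $p_{m'}$ are pairwise distinct. The gap is $gap(a)=\max\{a_i-a_{i-1}: i=2,\ldots,k\}$. An $m$-totative $k$-tuple $a[t]$ is isolated at level $m$ if neither $a[t-a_2]$ nor $a[t+a_2]$ is an $m$-totative $k$-tuple. -}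

module Defs where

open import Data.Nat as ℕ using (ℕ; zero; suc; _+_; _*_; _∸_; _≤_; _<_; _!; _⊔_)
open import Data.Nat.Properties using (≤-refl; ≤-trans; n≤1+n)
open import Data.Nat.DivMod using (_%_)
open import Data.Nat.Primality using (prime?)
open import Data.Nat.Coprimality using (Coprime)
open import Data.Integer as ℤ using (ℤ; +_)
open import Data.Fin using (Fin; toℕ) renaming (zero to fzero; suc to fsuc)
open import Data.Product using (Σ; _×_; ∃)
open import Relation.Nullary using (¬_; yes; no)
open import Relation.Binary.PropositionalEquality using (_≡_)

searchPrime : (fuel n : ℕ) → ℕ
searchPrime zero    n = n
searchPrime (suc f) n with prime? n
... | yes _ = n
... | no  _ = searchPrime f (suc n)

-- The least prime > n (by Euclid it lies in n+1 .. n!+1, inside the fuel).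
nextPrime : ℕ → ℕ
nextPrime n = searchPrime (suc (n !)) (suc n)

prime0 : ℕ → ℕ
prime0 zero    = 2
prime0 (suc i) = nextPrime (prime0 i)

-- p i = i-th prime for i ≥ 1 (p 0 is junk, never used).
p : ℕ → ℕ
p i = prime0 (i ∸ 1)

searchPrime-≥ : ∀ f n → n ≤ searchPrime f n
searchPrime-≥ zero    n = ≤-refl
searchPrime-≥ (suc f) n with prime? n
... | yes _ = ≤-refl
... | no  _ = ≤-trans (n≤1+n n) (searchPrime-≥ f (suc n))

prime0-nonZero : ∀ i → ℕ.NonZero (prime0 i)
prime0-nonZero zero    = _
prime0-nonZero (suc i) = ℕ.>-nonZero (≤-trans (ℕ.s≤s ℕ.z≤n) (searchPrime-≥ (suc (prime0 i !)) (suc (prime0 i))))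

p-nonZero : ∀ i → ℕ.NonZero (p i)
p-nonZero i = prime0-nonZero (i ∸ 1)

primorial : ℕ → ℕ
primorial zero    = 1
primorial (suc m) = primorial m * p (suc m)

Totative : ℕ → ℕ → Set
Totative m x = 2 ≤ x × x ≤ primorial m + 1 × Coprime x (primorial m)

Totativeℤ : ℕ → ℤ → Set
Totativeℤ m z = Σ ℕ (λ x → z ≡ + x × Totative m x)

-- k-tuples a = (a_1, ..., a_k) are functions Fin k → ℕ
-- (index i : Fin k corresponds to a_{toℕ i + 1}).

shift : ∀ {k} → (Fin k → ℕ) → ℤ → (Fin k → ℤ)
shift a t i = t ℤ.+ + a i

TotativeTuple : ∀ {k} → ℕ → (Fin k → ℤ) → Set
TotativeTuple m v = ∀ i → Totativeℤ m (v i)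

Satisfies : ∀ {k} → ℕ → (Fin k → ℕ) → ℤ → Set
Satisfies m a t = TotativeTuple m (shift a t)

Admissible : ∀ {k} → ℕ → (Fin k → ℕ) → Set
Admissible {k} m a =
    (∀ (i : Fin k) → toℕ i ≡ 0 → a i ≡ 0)
  × (∀ (i j : Fin k) → toℕ j ≡ suc (toℕ i) → a i < a j)
  × (∀ m′ → m ≤ m′ → Σ ℕ (λ t → Totative m′ t × Satisfies m′ a (+ t)))

StrongAdmissible : ∀ {k} → ℕ → (Fin k → ℕ) → Set
StrongAdmissible {k} m a =
    Admissible m a
  × (∀ m′ → m ≤ m′ → ∀ (i j : Fin k) → ℕ._%_ (a i) (p m′) {{p-nonZero m′}} ≡ ℕ._%_ (a j) (p m′) {{p-nonZero m′}} → i ≡ j)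

gap : ∀ {k} → (Fin k → ℕ) → ℕ
gap {zero}        a = 0
gap {suc zero}    a = 0
gap {suc (suc k)} a = (a (fsuc fzero) ∸ a fzero) ⊔ gap (λ i → a (fsuc i))

-- the second entry a_2 (only meaningful for k ≥ 2; 0 otherwise)
second : ∀ {k} → (Fin k → ℕ) → ℕ
second {suc (suc k)} a = a (fsuc fzero)
second {_}           a = 0

Isolated : ∀ {k} → ℕ → (Fin k → ℕ) → ℤ → Set
Isolated m a t =
    Satisfies m a t
  × ¬ Satisfies m a (t ℤ.- + second a)
  × ¬ Satisfies m a (t ℤ.+ + second a)

-- Write P = p_n and q = #(n-1), so that #(n) = q P, and let s = a_2.  Since
-- q is invertible modulo P, for each i exactly one j < P makes P divide the
-- entry t' + a_i + j q of a[t' + j q], and by strong admissibility these k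
-- values of j are distinct.  For each of the other P - k values the tuple
-- a[t' + j q] is n-totative: it stays coprime to q and below q P + 1.  It is
-- moreover isolated, because an n-totative neighbour a[t' + j q ± s] reduces
-- modulo q to an (n-1)-totative tuple a[t' ± s].  The only delicate point is
-- the upper bound q + 1 for the entries of a[t' + s]: an entry y in
-- [q + 2, q + P) would give y - q in [2, P) coprime to q, but every such
-- number has a prime factor below P.
module Submission where

open import Defs
open import Data.Fin as Fin using (Fin; toℕ; fromℕ<)
import Data.Fin.Properties as Finₚ
open import Data.Fin.Subset using (Subset; _∈_; _∉_; ∣_∣; ∁; _-_; inside; outside)
open import Data.Fin.Subset.Properties
  using (p─⊥≡p; p─q⊆p; x∈p∧x≢y⇒x∈p-y; Empty-unique; ∣⊥∣≡0; ∣∁p∣≡n∸∣p∣; x∈∁p⇒x∉p; x∉p⇒x∈∁p)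
open import Data.Integer as ℤ using (+_)
import Data.Integer.Properties as ℤₚ
open import Data.List using ([]; _∷_)
open import Data.Nat.ListAction using (product)
import Data.List.Relation.Unary.All as All
open import Data.Nat hiding (∣_-_∣)
open import Data.Nat.Coprimality as Coprimality using (Coprime; coprime-divisor; coprime-Bézout)
open import Data.Nat.DivMod
open import Data.Nat.Divisibility
open import Data.Nat.GCD using (module Bézout)
open import Data.Nat.Primality
open import Data.Nat.Primality.Factorisation using (factorise)
open import Data.Nat.Properties
open import Data.Nat.Tactic.RingSolver using (solve; solve-∀)
open import Algebra.Properties.CommutativeSemigroup +-commutativeSemigroup
  using () renaming
  (xy∙z≈xz∙y to x+y+z≡x+z+y; xy∙z≈y∙xz to x+y+z≡y+[x+z]; x∙yz≈y∙xz to x+[y+z]≡y+[x+z])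
open import Data.Product using (Σ; ∃-syntax; _×_; _,_; proj₁; proj₂)
open import Data.Sum using (inj₁; inj₂)
import Data.Vec as Vec
open import Data.Vec using (tabulate; lookup; here; there)
open import Data.Vec.Properties using (lookup∘tabulate; []=⇒lookup; lookup⇒[]=)
open import Data.Bool.Properties using (T-≡)
open import Function.Base using (_∘_; case_of_)
open import Function.Bundles using (_⇔_; mk⇔; Equivalence)
open import Function.Definitions using (Injective)
open import Relation.Binary.PropositionalEquality
open import Relation.Binary.Definitions using (tri<; tri≈; tri>)
open import Relation.Nullary using (¬_; yes; no; contradiction)
open import Relation.Nullary.Decidable using (isYes; toWitness; fromWitness)

open Equivalence using (to; from)

prime⇒2≤ : ∀ {r} → Prime r → 2 ≤ r
prime⇒2≤ {r} pr = nonTrivial⇒n>1 r {{prime⇒nonTrivial pr}}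

prime⇒≢1 : ∀ {r} → Prime r → r ≢ 1
prime⇒≢1 pr = nonTrivial⇒≢1 {{prime⇒nonTrivial pr}}

coprime-shift : ∀ {x q} j → Coprime x q → Coprime (x + j * q) q
coprime-shift {x} {q} j x⊥q {d} (d∣ , d∣q) =
  x⊥q (∣m+n∣m⇒∣n (subst (d ∣_) (+-comm x (j * q)) d∣) (∣n⇒∣m*n j d∣q) , d∣q)

coprime-unshift : ∀ {x q} j → Coprime (x + j * q) q → Coprime x q
coprime-unshift j c (d∣x , d∣q) = c (∣m∣n⇒∣m+n d∣x (∣n⇒∣m*n j d∣q) , d∣q)

coprime-*⁻ˡ : ∀ {x q r} → Coprime x (q * r) → Coprime x q
coprime-*⁻ˡ {r = r} c (d∣x , d∣q) = c (d∣x , ∣m⇒∣m*n r d∣q)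

coprime-*⁻ʳ : ∀ {x q r} → Coprime x (q * r) → Coprime x r
coprime-*⁻ʳ {q = q} c (d∣x , d∣r) = c (d∣x , ∣n⇒∣m*n q d∣r)

coprime-*⁺ : ∀ {x q r} → Coprime x q → Coprime x r → Coprime x (q * r)
coprime-*⁺ x⊥q x⊥r (d∣x , d∣qr) =
  x⊥r (d∣x , coprime-divisor (λ (e∣d , e∣q) → x⊥q (∣-trans e∣d d∣x , e∣q)) d∣qr)

coprime⇒∤ : ∀ {x r} → Prime r → Coprime x r → r ∤ x
coprime⇒∤ pr x⊥r r∣x = prime⇒≢1 pr (x⊥r (r∣x , ∣-refl))

∤⇒coprime : ∀ {x r} → Prime r → r ∤ x → Coprime x r
∤⇒coprime pr r∤x (d∣x , d∣r) with prime⇒irreducible pr d∣r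
... | inj₁ d≡1 = d≡1
... | inj₂ refl = contradiction d∣x r∤x

-- The enumeration prime0 and primorials

∃prime∣ : ∀ {n} → 2 ≤ n → ∃[ d ] Prime d × d ∣ n
∃prime∣ {n} (s≤s (s≤s _)) with factorise n
... | record { factors = d ∷ ds ; isFactorisation = n≡ ; factorsPrime = pd All.∷ _ } =
  d , pd , subst (d ∣_) (sym n≡) (m∣m*n (product ds))

0<m≤n⇒m∣n! : ∀ {m n} → 0 < m → m ≤ n → m ∣ n !
0<m≤n⇒m∣n! {suc m} _ m≤n = ∣-trans (m∣m*n (m !)) (m≤n⇒m!∣n! m≤n)

-- Euclid: a prime divisor of n! + 1 cannot be at most n.
∃prime>n∧≤1+n! : ∀ n → ∃[ r ] Prime r × n < r × r ≤ suc (n !)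
∃prime>n∧≤1+n! n with ∃prime∣ (s≤s (1≤n! n))
... | d , pd , d∣1+n! = d , pd , ≰⇒> d≰n , ∣⇒≤ d∣1+n!
  where
  d∣n!+1 : d ∣ n ! + 1
  d∣n!+1 = subst (d ∣_) (+-comm 1 (n !)) d∣1+n!
  d≰n : d ≰ n
  d≰n d≤n = prime⇒≢1 pd (∣1⇒≡1 (∣m+n∣m⇒∣n d∣n!+1 (0<m≤n⇒m∣n! (<-trans z<s (prime⇒2≤ pd)) d≤n)))

searchPrime-prime : ∀ f n {r} → Prime r → n ≤ r → r < n + f → Prime (searchPrime f n)
searchPrime-prime zero n {r} _ n≤r r<n+0 =
  contradiction (subst (r <_) (+-identityʳ n) r<n+0) (≤⇒≯ n≤r)
searchPrime-prime (suc f) n {r} pr n≤r r< with prime? n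
... | yes pn = pn
... | no ¬pn = searchPrime-prime f (suc n) pr n<r (subst (r <_) (+-suc n f) r<)
  where
  n<r : n < r
  n<r with m≤n⇒m<n∨m≡n n≤r
  ... | inj₁ n<r = n<r
  ... | inj₂ refl = contradiction pr ¬pn

searchPrime-least : ∀ f n {y} → n ≤ y → y < searchPrime f n → ¬ Prime y
searchPrime-least zero n n≤y y<n = contradiction n≤y (<⇒≱ y<n)
searchPrime-least (suc f) n n≤y y< with prime? n
... | yes _ = contradiction n≤y (<⇒≱ y<)
... | no ¬pn with m≤n⇒m<n∨m≡n n≤y
...   | inj₁ n<y = searchPrime-least f (suc n) n<y y<
...   | inj₂ refl = ¬pn

nextPrime-prime : ∀ n → Prime (nextPrime n)
nextPrime-prime n with ∃prime>n∧≤1+n! n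
... | r , pr , n<r , r≤ =
  searchPrime-prime (suc (n !)) (suc n) pr n<r (s≤s (≤-trans r≤ (m≤n+m _ n)))

n<nextPrime : ∀ n → n < nextPrime n
n<nextPrime n = searchPrime-≥ (suc (n !)) (suc n)

prime0-prime : ∀ i → Prime (prime0 i)
prime0-prime zero    = prime[2]
prime0-prime (suc i) = nextPrime-prime (prime0 i)

-- Since nextPrime skips no prime, prime0 enumerates all primes in order.
prime<prime0⇒∣primorial : ∀ i {r} → Prime r → r < prime0 i → r ∣ primorial i
prime<prime0⇒∣primorial zero    pr r<2 = contradiction (prime⇒2≤ pr) (<⇒≱ r<2)
prime<prime0⇒∣primorial (suc i) {r} pr r< with <-cmp r (prime0 i)
... | tri< r<P _ _ = ∣m⇒∣m*n (prime0 i) (prime<prime0⇒∣primorial i pr r<P)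
... | tri≈ _ refl _ = ∣n⇒∣m*n (primorial i) ∣-refl
... | tri> _ _ P<r = contradiction pr (searchPrime-least (suc (prime0 i !)) (suc (prime0 i)) P<r r<)

prime∣primorial⇒<prime0 : ∀ i {r} → Prime r → r ∣ primorial i → r < prime0 i
prime∣primorial⇒<prime0 zero    pr r∣1 = s≤s (∣⇒≤ r∣1)
prime∣primorial⇒<prime0 (suc i) pr r∣ with euclidsLemma (primorial i) (prime0 i) pr r∣
... | inj₁ r∣q = <-trans (prime∣primorial⇒<prime0 i pr r∣q) (n<nextPrime (prime0 i))
... | inj₂ r∣P = ≤-<-trans (∣⇒≤ {{prime⇒nonZero (prime0-prime i)}} r∣P) (n<nextPrime (prime0 i))

prime0-coprime-primorial : ∀ i → Coprime (prime0 i) (primorial i)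
prime0-coprime-primorial i = Coprimality.sym (∤⇒coprime (prime0-prime i) λ P∣q →
  <-irrefl refl (prime∣primorial⇒<prime0 i (prime0-prime i) P∣q))

coprime-primorial⇒prime0≤ : ∀ i {x} → 2 ≤ x → Coprime x (primorial i) → prime0 i ≤ x
coprime-primorial⇒prime0≤ i {x} 2≤x x⊥q with ∃prime∣ 2≤x
... | d , pd , d∣x = ≮⇒≥ λ x<P →
  prime⇒≢1 pd (x⊥q (d∣x , prime<prime0⇒∣primorial i pd (≤-<-trans (∣⇒≤ d∣x) x<P)))
  where instance _ = >-nonZero (≤-trans z<s 2≤x)

coprime-primorial⇒≤1+primorial : ∀ i {x} → Coprime x (primorial i) →
  x < primorial i + prime0 i → x ≤ primorial i + 1
coprime-primorial⇒≤1+primorial i {x} x⊥q x<q+P with x ≤? primorial i + 1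
... | yes x≤q+1 = x≤q+1
... | no x≰q+1 =
  contradiction (coprime-primorial⇒prime0≤ i 2≤x∸q (coprime-unshift 1 x∸q⊥q)) (<⇒≱ x∸q<P)
  where
  q = primorial i
  q+2≤x : 2 + q ≤ x
  q+2≤x = subst (_≤ x) (+-comm (suc q) 1) (≰⇒> x≰q+1)
  2≤x∸q : 2 ≤ x ∸ q
  2≤x∸q = m+n≤o⇒m≤o∸n 2 q+2≤x
  x∸q<P : x ∸ q < prime0 i
  x∸q<P = m<n+o⇒m∸n<o x q {{prime0-nonZero i}} x<q+P
  x∸q⊥q : Coprime (x ∸ q + 1 * q) q
  x∸q⊥q = subst (λ z → Coprime z q)
    (trans (sym (m∸n+n≡m (m+n≤o⇒n≤o 2 q+2≤x))) (cong (_+_ (x ∸ q)) (sym (*-identityˡ q)))) x⊥q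

-- Solving c + j q ≡ 0 modulo d

∣∧<⇒≡0 : ∀ {d n} → d ∣ n → n < d → n ≡ 0
∣∧<⇒≡0 {n = zero}  _   _   = refl
∣∧<⇒≡0 {n = suc n} d∣n n<d = contradiction d∣n (>⇒∤ n<d)

∣m+o∣n+o⇒m%d≡n%d : ∀ {d} .{{_ : NonZero d}} {m n o} → d ∣ m + o → d ∣ n + o → m % d ≡ n % d
∣m+o∣n+o⇒m%d≡n%d {d} {m} {n} {o} d∣m+o d∣n+o = begin
  m % d             ≡⟨ %-remove-+ʳ m d∣n+o ⟨
  (m + (n + o)) % d ≡⟨ cong (_% d) (x+[y+z]≡y+[x+z] m n o) ⟩
  (n + (m + o)) % d ≡⟨ %-remove-+ʳ n d∣m+o ⟩
  n % d             ∎
  where open ≡-Reasoning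

-- The witness is j ≡ - c q⁻¹ (mod d), written without subtraction: when x q ≡ 1 we use
-- - 1 ≡ d′ = d - 1, and when x q ≡ - 1 the inverse of q is - x.
∃-solutionℕ : ∀ {d q} .{{_ : NonZero d}} → Coprime d q → ∀ c → ∃[ j ] d ∣ c + j * q
∃-solutionℕ {suc d′} {q} d⊥q c with coprime-Bézout (Coprimality.sym d⊥q)
... | Bézout.+- x y xq≡1+yd = c * d′ * x , divides (c + c * d′ * y) (begin
  c + c * d′ * x * q              ≡⟨ cong (_+_ c) (*-assoc (c * d′) x q) ⟩
  c + c * d′ * (x * q)            ≡⟨ cong (λ z → c + c * d′ * z) xq≡1+yd ⟨
  c + c * d′ * (1 + y * suc d′)   ≡⟨ solve (c ∷ d′ ∷ y ∷ []) ⟩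
  (c + c * d′ * y) * suc d′       ∎)
  where open ≡-Reasoning
... | Bézout.-+ x y 1+xq≡yd = c * x , divides (c * y) (begin
  c + c * x * q   ≡⟨ solve (c ∷ x ∷ q ∷ []) ⟩
  c * (1 + x * q) ≡⟨ cong (c *_) 1+xq≡yd ⟩
  c * (y * suc d′) ≡⟨ *-assoc c y (suc d′) ⟨
  c * y * suc d′  ∎)
  where open ≡-Reasoning

∃-solution : ∀ {d q} .{{_ : NonZero d}} → Coprime d q → ∀ c → ∃[ j ] d ∣ c + toℕ {d} j * q
∃-solution {d} {q} d⊥q c with ∃-solutionℕ d⊥q c
... | j , d∣c+jq = fromℕ< (m%n<n j d) ,
  subst (λ z → d ∣ c + z * q) (sym (Finₚ.toℕ-fromℕ< (m%n<n j d)))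
    (∣m+n∣m⇒∣n (subst (d ∣_) split d∣c+jq) (n∣m*n (j / d * q)))
  where
  split : c + j * q ≡ j / d * q * d + (c + j % d * q)
  split = begin
    c + j * q                   ≡⟨ cong (λ z → c + z * q) (m≡m%n+[m/n]*n j d) ⟩
    c + (j % d + j / d * d) * q ≡⟨ regroup c (j % d) (j / d) d q ⟩
    j / d * q * d + (c + j % d * q) ∎
    where
    open ≡-Reasoning
    regroup : ∀ c r s d q → c + (r + s * d) * q ≡ s * q * d + (c + r * q)
    regroup = solve-∀

solution-uniqueℕ : ∀ {d q c j j′} → Coprime d q → j ≤ j′ → j′ < d →
  d ∣ c + j * q → d ∣ c + j′ * q → j ≡ j′
solution-uniqueℕ {d} {q} {c} {j} {j′} d⊥q j≤j′ j′<d d∣c+jq d∣c+j′q =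
  ≤-antisym j≤j′ (m∸n≡0⇒m≤n (∣∧<⇒≡0 d∣j′∸j (≤-<-trans (m∸n≤m j′ j) j′<d)))
  where
  split : c + j′ * q ≡ c + j * q + q * (j′ ∸ j)
  split = begin
    c + j′ * q                 ≡⟨ cong (λ z → c + z * q) (m+[n∸m]≡n j≤j′) ⟨
    c + (j + (j′ ∸ j)) * q     ≡⟨ regroup c j (j′ ∸ j) q ⟩
    c + j * q + q * (j′ ∸ j)   ∎
    where
    open ≡-Reasoning
    regroup : ∀ c j e q → c + (j + e) * q ≡ c + j * q + q * e
    regroup = solve-∀
  d∣j′∸j : d ∣ j′ ∸ j
  d∣j′∸j = coprime-divisor d⊥q (∣m+n∣m⇒∣n (subst (d ∣_) split d∣c+j′q) d∣c+jq)

solution-unique : ∀ {d q c} {j j′ : Fin d} → Coprime d q →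
  d ∣ c + toℕ j * q → d ∣ c + toℕ j′ * q → j ≡ j′
solution-unique {j = j} {j′} d⊥q d∣c+jq d∣c+j′q with ≤-total (toℕ j) (toℕ j′)
... | inj₁ j≤j′ = Finₚ.toℕ-injective (solution-uniqueℕ d⊥q j≤j′ (Finₚ.toℕ<n j′) d∣c+jq d∣c+j′q)
... | inj₂ j′≤j = Finₚ.toℕ-injective (sym (solution-uniqueℕ d⊥q j′≤j (Finₚ.toℕ<n j) d∣c+j′q d∣c+jq))

-- Images of maps between finite sets

image : ∀ {k n} → (Fin k → Fin n) → Subset n
image f = tabulate λ y → isYes (Finₚ.any? λ i → f i Finₚ.≟ y)

∈-image⇔ : ∀ {k n} {f : Fin k → Fin n} {y} → y ∈ image f ⇔ (∃[ i ] f i ≡ y)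
∈-image⇔ {f = f} {y} = mk⇔
  (λ y∈ → toWitness {a? = y∈image?} (from T-≡ (trans (sym lookup-image) ([]=⇒lookup y∈))))
  (λ ∃i → lookup⇒[]= y (image f) (trans lookup-image (to T-≡ (fromWitness ∃i))))
  where
  y∈image? = Finₚ.any? λ i → f i Finₚ.≟ y
  lookup-image : lookup (image f) y ≡ isYes y∈image?
  lookup-image = lookup∘tabulate _ y

x∈p⇒∣p∣≡1+∣p-x∣ : ∀ {n} {p : Subset n} {x} → x ∈ p → ∣ p ∣ ≡ suc ∣ p - x ∣
x∈p⇒∣p∣≡1+∣p-x∣ {p = inside Vec.∷ p}  here        = cong suc (cong ∣_∣ (sym (p─⊥≡p p)))
x∈p⇒∣p∣≡1+∣p-x∣ {p = inside Vec.∷ p}  (there x∈p) = cong suc (x∈p⇒∣p∣≡1+∣p-x∣ x∈p)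
x∈p⇒∣p∣≡1+∣p-x∣ {p = outside Vec.∷ p} (there x∈p) = x∈p⇒∣p∣≡1+∣p-x∣ x∈p

x∉p-x : ∀ {n} (p : Subset n) x → x ∉ p - x
x∉p-x (_ Vec.∷ p) (Fin.suc x) (there x∈p-x) = x∉p-x p x x∈p-x

image-size : ∀ {k n} (f : Fin k → Fin n) → Injective _≡_ _≡_ f →
  (p : Subset n) → (∀ y → y ∈ p ⇔ (∃[ i ] f i ≡ y)) → ∣ p ∣ ≡ k
image-size {zero} {n} f _ p p≐f =
  trans (cong ∣_∣ (Empty-unique λ (y , y∈p) → no-index (to (p≐f y) y∈p))) (∣⊥∣≡0 n)
  where
  no-index : ∀ {y} → ¬ (∃[ i ] f i ≡ y)
  no-index (() , _)
image-size {suc k} f f-inj p p≐f =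
  trans (x∈p⇒∣p∣≡1+∣p-x∣ f₀∈p)
    (cong suc (image-size (f ∘ Fin.suc) (Finₚ.suc-injective ∘ f-inj) (p - f Fin.zero) p-f₀≐))
  where
  f₀∈p : f Fin.zero ∈ p
  f₀∈p = from (p≐f _) (Fin.zero , refl)
  p-f₀≐ : ∀ y → y ∈ p - f Fin.zero ⇔ (∃[ i ] f (Fin.suc i) ≡ y)
  p-f₀≐ y = mk⇔ index index⁻¹
    where
    index : y ∈ p - f Fin.zero → ∃[ i ] f (Fin.suc i) ≡ y
    index y∈ with to (p≐f y) (p─q⊆p p _ y∈)
    ... | Fin.zero , refl = contradiction y∈ (x∉p-x p _)
    ... | Fin.suc i , fi≡y = i , fi≡y
    index⁻¹ : ∃[ i ] f (Fin.suc i) ≡ y → y ∈ p - f Fin.zero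
    index⁻¹ (i , refl) =
      x∈p∧x≢y⇒x∈p-y (from (p≐f _) (Fin.suc i , refl)) λ eq → case f-inj eq of λ ()

∣image∣≡k : ∀ {k n} (f : Fin k → Fin n) → Injective _≡_ _≡_ f → ∣ image f ∣ ≡ k
∣image∣≡k f f-inj = image-size f f-inj (image f) λ _ → ∈-image⇔

+m-+n≡+[m∸n] : ∀ {m n} → n ≤ m → + m ℤ.- + n ≡ + (m ∸ n)
+m-+n≡+[m∸n] {m} {n} n≤m = trans (ℤₚ.m-n≡m⊖n m n) (ℤₚ.⊖-≥ n≤m)

satisfies⁺ : ∀ l {k} (a : Fin k → ℕ) t → (∀ i → Totative l (t + a i)) → Satisfies l a (+ t)
satisfies⁺ _ a t h i = t + a i , refl , h i

satisfies⁻ : ∀ l {k} (a : Fin k → ℕ) t → Satisfies l a (+ t) → ∀ i → Totative l (t + a i)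
satisfies⁻ l a t h i with h i
... | _ , eq , totative = subst (Totative l) (sym (ℤₚ.+-injective eq)) totative

second≤gap : ∀ {k} (a : Fin k → ℕ) → (∀ i → toℕ i ≡ 0 → a i ≡ 0) → second a ≤ gap a
second≤gap {zero}        a _  = z≤n
second≤gap {suc zero}    a _  = z≤n
second≤gap {suc (suc k)} a a₁≡0 =
  subst (_≤ gap a) (cong (a (Fin.suc Fin.zero) ∸_) (a₁≡0 Fin.zero refl)) (m≤m⊔n _ _)

-- From level m to level m + 1

module Lift (m : ℕ) where

  private
    P = prime0 m
    q = primorial m
    P-prime = prime0-prime m
    instance
      P-nonZero : NonZero P
      P-nonZero = prime0-nonZero m

  totative-lift : ∀ {x j} → Totative m x → j < P → P ∤ x + j * q → Totative (suc m) (x + j * q)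
  totative-lift {x} {j} (2≤x , x≤q+1 , x⊥q) j<P P∤ =
    ≤-trans 2≤x (m≤m+n x _) , bound , coprime-*⁺ (coprime-shift j x⊥q) (∤⇒coprime P-prime P∤)
    where
    bound : x + j * q ≤ q * P + 1
    bound = begin
      x + j * q      ≤⟨ +-monoˡ-≤ (j * q) x≤q+1 ⟩
      q + 1 + j * q  ≡⟨ x+y+z≡x+z+y q 1 (j * q) ⟩
      suc j * q + 1  ≤⟨ +-monoˡ-≤ 1 (*-monoˡ-≤ q j<P) ⟩
      P * q + 1      ≡⟨ cong (_+ 1) (*-comm P q) ⟩
      q * P + 1      ∎
      where open ≤-Reasoning

  totative-reduce : ∀ x j → Totative (suc m) (x + j * q) → 2 ≤ x → x < q + P → Totative m x
  totative-reduce x j (_ , _ , c) 2≤x x<q+P =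
    2≤x , coprime-primorial⇒≤1+primorial m x⊥q x<q+P , x⊥q
    where
    x⊥q : Coprime x q
    x⊥q = coprime-unshift j (coprime-*⁻ˡ {r = P} c)

  module _ {k} {a : Fin k → ℕ} where

    satisfies-lift : ∀ t {j} → j < P → Satisfies m a (+ t) →
      (∀ i → P ∤ t + a i + j * q) → Satisfies (suc m) a (+ (t + j * q))
    satisfies-lift t {j} j<P sat P∤ = satisfies⁺ (suc m) a (t + j * q) λ i →
      subst (Totative (suc m)) (x+y+z≡x+z+y t (a i) (j * q))
        (totative-lift (satisfies⁻ m a t sat i) j<P (P∤ i))

    satisfies-reduce : ∀ u j → Satisfies (suc m) a (+ (u + j * q)) → 2 ≤ u →
      (∀ i → u + a i < q + P) → Satisfies m a (+ u)
    satisfies-reduce u j sat 2≤u bound = satisfies⁺ m a u λ i →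
      totative-reduce (u + a i) j
        (subst (Totative (suc m)) (x+y+z≡x+z+y u (j * q) (a i))
          (satisfies⁻ (suc m) a (u + j * q) sat i))
        (≤-trans 2≤u (m≤m+n u (a i))) (bound i)

    satisfies-suc⇒∤ : ∀ t → Satisfies (suc m) a (+ t) → ∀ i → P ∤ t + a i
    satisfies-suc⇒∤ t sat i =
      coprime⇒∤ P-prime (coprime-*⁻ʳ {q = q} (proj₂ (proj₂ (satisfies⁻ (suc m) a t sat i))))

  module _ {k} (a : Fin k → ℕ) (2+s≤P : 2 + second a ≤ P)
           {t′} (t′-totative : Totative m t′) (isolated : Isolated m a (+ t′)) where

    private
      s : ℕ
      s = second a
      sat : Satisfies m a (+ t′)
      sat = proj₁ isolated
      entry≤ : ∀ i → t′ + a i ≤ q + 1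
      entry≤ i = proj₁ (proj₂ (satisfies⁻ m a t′ sat i))
      2+s≤t′ : 2 + s ≤ t′
      2+s≤t′ = ≤-trans 2+s≤P
        (coprime-primorial⇒prime0≤ m (proj₁ t′-totative) (proj₂ (proj₂ t′-totative)))
      s≤t′ : s ≤ t′
      s≤t′ = m+n≤o⇒n≤o 2 2+s≤t′

    no-lower-neighbour : ∀ j → ¬ Satisfies (suc m) a (+ (t′ + j * q) ℤ.- + s)
    no-lower-neighbour j sat↓ = proj₁ (proj₂ isolated)
      (subst (Satisfies m a) (sym (+m-+n≡+[m∸n] s≤t′))
        (satisfies-reduce (t′ ∸ s) j sat↓′ (m+n≤o⇒m≤o∸n 2 2+s≤t′) bound))
      where
      sat↓′ : Satisfies (suc m) a (+ (t′ ∸ s + j * q))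
      sat↓′ = subst (Satisfies (suc m) a)
        (trans (+m-+n≡+[m∸n] (≤-trans s≤t′ (m≤m+n t′ (j * q)))) (cong +_ (+-∸-comm (j * q) s≤t′)))
        sat↓
      bound : ∀ i → t′ ∸ s + a i < q + P
      bound i = begin-strict
        t′ ∸ s + a i ≤⟨ +-monoˡ-≤ (a i) (m∸n≤m t′ s) ⟩
        t′ + a i     ≤⟨ entry≤ i ⟩
        q + 1        <⟨ +-monoʳ-< q (prime⇒2≤ P-prime) ⟩
        q + P        ∎
        where open ≤-Reasoning

    no-upper-neighbour : ∀ j → ¬ Satisfies (suc m) a (+ (t′ + j * q) ℤ.+ + s)
    no-upper-neighbour j sat↑ = proj₂ (proj₂ isolated)
      (satisfies-reduce (t′ + s) j sat↑′ (≤-trans (proj₁ t′-totative) (m≤m+n t′ s)) bound)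
      where
      sat↑′ : Satisfies (suc m) a (+ (t′ + s + j * q))
      sat↑′ = subst (Satisfies (suc m) a) (cong +_ (x+y+z≡x+z+y t′ (j * q) s)) sat↑
      bound : ∀ i → t′ + s + a i < q + P
      bound i = begin-strict
        t′ + s + a i ≡⟨ x+y+z≡x+z+y t′ s (a i) ⟩
        t′ + a i + s ≤⟨ +-monoˡ-≤ s (entry≤ i) ⟩
        q + 1 + s    ≡⟨ +-assoc q 1 s ⟩
        q + suc s    <⟨ +-monoʳ-< q (n<1+n (suc s)) ⟩
        q + (2 + s)  ≤⟨ +-monoʳ-≤ q 2+s≤P ⟩
        q + P        ∎
        where open ≤-Reasoning

    isolated-lift⇔ : ∀ {j} → j < P →
      Isolated (suc m) a (+ (t′ + j * q)) ⇔ (∀ i → P ∤ t′ + a i + j * q)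
    isolated-lift⇔ {j} j<P = mk⇔
      (λ isolated′ i → subst (P ∤_) (x+y+z≡x+z+y t′ (j * q) (a i))
                         (satisfies-suc⇒∤ (t′ + j * q) (proj₁ isolated′) i))
      (λ P∤ → satisfies-lift t′ j<P sat P∤ , no-lower-neighbour j , no-upper-neighbour j)

    root : Fin k → Fin P
    root i = proj₁ (∃-solution (prime0-coprime-primorial m) (t′ + a i))

    root-∣ : ∀ i → P ∣ t′ + a i + toℕ (root i) * q
    root-∣ i = proj₂ (∃-solution (prime0-coprime-primorial m) (t′ + a i))

    root-unique : ∀ {i j} → P ∣ t′ + a i + toℕ j * q → root i ≡ j
    root-unique = solution-unique (prime0-coprime-primorial m) (root-∣ _)

    root-injective : (∀ i i′ → a i % P ≡ a i′ % P → i ≡ i′) → Injective _≡_ _≡_ root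
    root-injective distinct {i} {i′} root-i≡root-i′ = distinct i i′
      (∣m+o∣n+o⇒m%d≡n%d (regroup (root-∣ i))
        (regroup (subst (λ j → P ∣ t′ + a i′ + toℕ j * q) (sym root-i≡root-i′) (root-∣ i′))))
      where
      regroup : ∀ {i″} → P ∣ t′ + a i″ + toℕ (root i) * q → P ∣ a i″ + (t′ + toℕ (root i) * q)
      regroup {i″} = subst (P ∣_) (x+y+z≡y+[x+z] t′ (a i″) (toℕ (root i) * q))

    ∈∁image-root⇔ : ∀ {j} → j ∈ ∁ (image root) ⇔ (∀ i → P ∤ t′ + a i + toℕ j * q)
    ∈∁image-root⇔ {j} = mk⇔
      (λ j∈ i P∣ → x∈∁p⇒x∉p j∈ (from ∈-image⇔ (i , root-unique P∣)))
      (λ P∤ → x∉p⇒x∈∁p λ j∈ → case to ∈-image⇔ j∈ of λ { (i , refl) → P∤ i (root-∣ i) })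

    isolated-lift-count : (∀ i i′ → a i % P ≡ a i′ % P → i ≡ i′) →
      Σ (Subset P) λ S → (∣ S ∣ ≡ P ∸ k) ×
        ((j : Fin P) → (j ∈ S) ⇔ Isolated (suc m) a (+ (t′ + toℕ j * q)))
    isolated-lift-count distinct = ∁ (image root) ,
      trans (∣∁p∣≡n∸∣p∣ (image root)) (cong (P ∸_) (∣image∣≡k root (root-injective distinct))) ,
      λ j → mk⇔ (from (isolated-lift⇔ (Finₚ.toℕ<n j)) ∘ to ∈∁image-root⇔)
                (from ∈∁image-root⇔ ∘ to (isolated-lift⇔ (Finₚ.toℕ<n j)))

theorem3 : (n k : ℕ) → 2 ≤ n → 2 ≤ k → (a : Fin k → ℕ) →
    StrongAdmissible (n ∸ 1) a → gap a < p n ∸ 1 →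
    (t′ : ℕ) → Totative (n ∸ 1) t′ → Satisfies (n ∸ 1) a (+ t′) →
    Isolated (n ∸ 1) a (+ t′) →
    Σ (Subset (p n)) (λ S →
    (∣ S ∣ ≡ p n ∸ k) ×
    ((j : Fin (p n)) →
    (j ∈ S) ⇔ Isolated n a (+ (t′ + toℕ j * primorial (n ∸ 1)))))
theorem3 (suc m) k _ _ a ((a₁≡0 , _) , distinct) gap<P∸1 t′ t′-totative _ isolated =
  Lift.isolated-lift-count m a 2+s≤P t′-totative isolated (distinct (suc m) (n≤1+n m))
  where
  2+s≤P : 2 + second a ≤ prime0 m
  2+s≤P = subst (_≤ prime0 m) (+-comm (suc (second a)) 1)
    (m≤o∸n⇒m+n≤o (suc (second a)) (<⇒≤ (prime⇒2≤ (prime0-prime m)))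
      (≤-<-trans (second≤gap a a₁≡0) gap<P∸1))
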